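{- Let $0<\epsilon<1$ and $C>0$. Then $$\frac{V(a,n)}{n}=\frac{1}{a}\sum_{s=1}^{a}\frac{\varphi(s)}{s}+o(1)\quad\text{as } n\to\infty,$$ uniformly over all integers $a$ with $1\le a<n$, $\gcd(a,n)=1$ and $a\le C n^{1-\epsilon}$; that is, for every $\eta>0$ there is $N$ such that for all $n\ge N$ and all such $a$, $\left|\frac{V(a,n)}{n}-\frac{1}{a}\sum_{s=1}^{a}\frac{\varphi(s)}{s}\right|<\eta$.
   Context: $\varphi$ is Euler's totient function. For integers $1\le a<n$ with $\gcd(a,n)=1$, $P_{a,n}=\{t_1(1,0)+t_2(a,n) : 0\le t_1,t_2\le 1\}$. A lattice point $(u_1,u_2)\in\mathbb{Z}^2$ is visible if $\gcd(u_1,u_2)=1$, and $V(a,n)$ is the number of visible lattice points in the interior of $P_{a,n}$.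
   Formalization: The parameters ε and C, as well as the tolerance η, are taken to be rational numbers. -}

module Defs where

open import Data.Nat as ℕ using (ℕ; zero; suc; _+_; _*_; _∸_; _^_; _<_; _≤_; NonZero)
open import Data.Nat.GCD using (gcd)
open import Data.Integer as ℤ using (ℤ; +_)
open import Data.Rational as ℚ using (ℚ; 0ℚ)
open import Data.List using (List; []; _∷_; filter; length; map; foldr; cartesianProduct)
open import Data.Product using (_×_; _,_)
open import Relation.Nullary.Decidable using (_×-dec_)
open import Relation.Binary.PropositionalEquality using (_≡_)

range : ℕ → ℕ → List ℕ
range m n = go m (suc n ∸ m)
  where
  go : ℕ → ℕ → List ℕ
  go k zero    = []
  go k (suc l) = k ∷ go (suc k) l

φ : ℕ → ℕ
φ s = length (filter (λ k → gcd k s ℕ.≟ 1) (range 1 s))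

-- Interior lattice points of P_{a,n} = {t₁(1,0) + t₂(a,n) : 0 ≤ t₁,t₂ ≤ 1}.
-- (x,y) = t₁(1,0)+t₂(a,n) with 0<t₁<1, 0<t₂<1  ⇔  0 < y < n  and  a·y < n·x < a·y + n.
-- All such points satisfy 0 < x < a+1, so it suffices to range over
-- x ∈ [1 .. a+1], y ∈ [1 .. n].
InteriorP : ℕ → ℕ → ℕ × ℕ → Set
InteriorP a n (x , y) = (0 < y × y < n) × (a * y < n * x × n * x < a * y + n)

interiorP? : ∀ a n p → Relation.Nullary.Decidable.Dec (InteriorP a n p)
interiorP? a n (x , y) =
  ((0 ℕ.<? y) ×-dec (y ℕ.<? n)) ×-dec ((a * y ℕ.<? n * x) ×-dec (n * x ℕ.<? a * y + n))

V : ℕ → ℕ → ℕ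
V a n = length (filter (λ p → interiorP? a n p ×-dec visible? p)
                       (cartesianProduct (range 1 (suc a)) (range 1 n)))
  where
  visible? : ∀ (p : ℕ × ℕ) → Relation.Nullary.Decidable.Dec (gcd (Data.Product.proj₁ p) (Data.Product.proj₂ p) ≡ 1)
  visible? (x , y) = gcd x y ℕ.≟ 1

sumℚ : List ℚ → ℚ
sumℚ = foldr ℚ._+_ 0ℚ

mainTerm : (a : ℕ) → .{{NonZero a}} → ℚ
mainTerm a = (+ 1 ℚ./ a) ℚ.* sumℚ (map term (range 1 a))
  where
  term : ℕ → ℚ
  term zero    = 0ℚ
  term (suc s) = + φ (suc s) ℚ./ suc s

-- a ≤ C · n^(1-ε)  with  C = c/d  and  ε = p/q  (all quantities positive),
-- equivalently (raising to the q-th power, multiplying by d^q):  (a·d)^q ≤ c^q · n^(q-p)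
BelowCPow : (c d p q : ℕ) → (a n : ℕ) → Set
BelowCPow c d p q a n = (a * d) ^ q ≤ c ^ q * n ^ (q ∸ p)

module Submission where

-- The visible interior points in column s (1 ≤ s ≤ a) are, apart from the single boundary
-- point (a, n), the y coprime to s with (s - 1)·n < a·y ≤ s·n.  A Legendre sieve over the
-- prime factors of s, peeled off by smallest prime factor, counts such y as φ(s)·n/(a·s) up to
-- an error e(s) = 2^ω(s), and e(s)^r ≤ K_r·s for every r since only primes below 2^r cost
-- anything.  Hence |V/n - (1/a) Σ φ(s)/s| ≤ (Σ_{s≤a} e(s) + 1)/n ≤ (2a·max e + 1)/n; taking
-- r = 2q - 1, the hypothesis a^q ≤ C^q·n^(q-p) makes the numerator O(n^(1 - 1/r)).

open import Defs

open import Data.Bool using (true; false; if_then_else_)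
open import Data.Empty using (⊥-elim)
open import Data.Nat
open import Data.Nat.Properties
open import Data.Nat.Divisibility
  using (_∣_; _∤_; _∣?_; divides; ∣-refl; ∣-trans; ∣⇒≤; m∣m*n; n∣m*n; ∣m+n∣m⇒∣n; n∣m⇒m%n≡0; _∣0; ∣1⇒≡1;
         quotient; quotient-<; quotient≢0; m∣n⇒n≡m*quotient)
open import Data.Nat.Coprimality as Coprime
  using (Coprime; coprime⇒gcd≡1; gcd≡1⇒coprime; coprime-divisor)
open import Data.Nat.GCD using (gcd)
open import Data.Nat.Primality
  using (Prime; prime⇒irreducible; prime⇒nonTrivial; prime⇒nonZero; _Rough_; 2-rough; ∤⇒rough-suc; rough∧∣⇒prime; rough∧∣⇒rough)
open import Data.Nat.Divisibility.Core using (hasNonTrivialDivisor)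
open import Data.Nat.DivMod using (_/_; _%_; m≡m%n+[m/n]*n; m%n<n; /-monoˡ-≤; m/n≤m; m<n*o⇒m/o<n; m*n/n≡m; m/n*n≤m)
open import Data.Nat.Induction using (<-rec)
open import Data.List using ([]; _∷_; _++_; [_]; _∷ʳ_; filter; length; map; applyUpTo; upTo; cartesianProduct)
open import Data.List.Properties using (length-applyUpTo; map-upTo; map-cong; map-applyUpTo; filter-++; length-++; applyUpTo-∷ʳ; map-++; map-cong-local)
open import Data.List.Extrema.Nat using (argmax; argmax-all; f[xs]≤f[argmax])
open import Data.List.Relation.Unary.All using (All; []; _∷_)
open import Data.List.Relation.Unary.All.Properties using (applyUpTo⁺₁)
open import Data.Nat.ListAction using (sum)
open import Data.Nat.ListAction.Properties using (sum-++)
open import Data.Product using (Σ; Σ-syntax; _×_; _,_; proj₁; proj₂)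
import Data.Integer as ℤ
import Data.Integer.Properties as ℤP
open import Data.Rational as ℚ using (ℚ; mkℚ; 0ℚ; toℚᵘ)
import Data.Rational.Properties as ℚP
open import Data.Rational.Unnormalised as ℚᵘ using (*≡*; *≤*; *<*)
import Data.Rational.Unnormalised.Properties as ℚᵘP
open import Data.Rational.Solver using (module +-*-Solver)
open import Data.Sum using (inj₁; inj₂)
open import Function.Base using (_∘_; _$_)
open import Function.Bundles using (_⇔_; mk⇔; Equivalence)
open import Relation.Nullary using (Dec; yes; no; does; ¬_)
open import Relation.Nullary.Decidable using (_×-dec_; ¬?)
open import Relation.Binary.PropositionalEquality hiding ([_])
open import Data.Nat.Tactic.RingSolver using (solve-∀)

open Equivalence using (to; from)

indicator : {A : Set} → Dec A → ℕ
indicator d = if does d then 1 else 0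

count : {P : ℕ → Set} → (∀ y → Dec (P y)) → ℕ → ℕ
count P? zero    = 0
count P? (suc m) = count P? m + indicator (P? m)

module _ {A B : Set} where

  indicator-cong : (a : Dec A) (b : Dec B) → A ⇔ B → indicator a ≡ indicator b
  indicator-cong (yes _) (yes _) _   = refl
  indicator-cong (no _)  (no _)  _   = refl
  indicator-cong (yes a) (no ¬b) A⇔B = ⊥-elim (¬b (to A⇔B a))
  indicator-cong (no ¬a) (yes b) A⇔B = ⊥-elim (¬a (from A⇔B b))

  indicator-split : (a : Dec A) (b : Dec B) → indicator a ≡ indicator (a ×-dec b) + indicator (a ×-dec ¬? b)
  indicator-split (yes _) (yes _) = refl
  indicator-split (yes _) (no _)  = refl
  indicator-split (no _)  (yes _) = refl
  indicator-split (no _)  (no _)  = refl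

indicator-yes : {A : Set} (a : Dec A) → A → indicator a ≡ 1
indicator-yes (yes _) _ = refl
indicator-yes (no ¬a) a = ⊥-elim (¬a a)

indicator-no : {A : Set} (a : Dec A) → ¬ A → indicator a ≡ 0
indicator-no (yes a) ¬a = ⊥-elim (¬a a)
indicator-no (no _)  _  = refl

count-none : {P : ℕ → Set} (P? : ∀ y → Dec (P y)) → ∀ m → (∀ y → y < m → ¬ P y) → count P? m ≡ 0
count-none P? zero    _  = refl
count-none P? (suc m) ¬P =
  cong₂ _+_ (count-none P? m (λ y y<m → ¬P y (m<n⇒m<1+n y<m))) (indicator-no (P? m) (¬P m ≤-refl))

module _ {P : ℕ → Set} (P? : ∀ y → Dec (P y)) where

  count-+ : ∀ m k → count P? (m + k) ≡ count P? m + count (λ y → P? (m + y)) k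
  count-+ m zero    = trans (cong (count P?) (+-identityʳ m)) (sym (+-identityʳ _))
  count-+ m (suc k) = trans (cong (count P?) (+-suc m k)) (trans (cong (_+ _) (count-+ m k)) (+-assoc (count P? m) _ _))

  count-bounded : ∀ m m′ → (∀ y → P y → y < m) → m ≤ m′ → count P? m′ ≡ count P? m
  count-bounded m m′ bound m≤m′ = begin
    count P? m′                                  ≡⟨ cong (count P?) (sym (m+[n∸m]≡n m≤m′)) ⟩
    count P? (m + (m′ ∸ m))                      ≡⟨ count-+ m (m′ ∸ m) ⟩
    count P? m + count (λ y → P? (m + y)) (m′ ∸ m) ≡⟨ cong (count P? m +_) (count-none _ (m′ ∸ m) (λ y _ p → m+n≮m m y (bound _ p))) ⟩
    count P? m + 0                               ≡⟨ +-identityʳ _ ⟩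
    count P? m                                   ∎
    where open ≡-Reasoning

module _ {P Q : ℕ → Set} (P? : ∀ y → Dec (P y)) (Q? : ∀ y → Dec (Q y)) where

  count-cong : ∀ m → (∀ y → y < m → P y ⇔ Q y) → count P? m ≡ count Q? m
  count-cong zero    _   = refl
  count-cong (suc m) P⇔Q =
    cong₂ _+_ (count-cong m (λ y y<m → P⇔Q y (m<n⇒m<1+n y<m))) (indicator-cong (P? m) (Q? m) (P⇔Q m ≤-refl))

  count-split : ∀ m → count P? m ≡ count (λ y → P? y ×-dec Q? y) m + count (λ y → P? y ×-dec ¬? (Q? y)) m
  count-split zero    = refl
  count-split (suc m) = begin
    count P? m + indicator (P? m)
      ≡⟨ cong₂ _+_ (count-split m) (indicator-split (P? m) (Q? m)) ⟩
    (count PQ m + count P¬Q m) + (indicator (PQ m) + indicator (P¬Q m))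
      ≡⟨ +-assoc-swap (count PQ m) (count P¬Q m) _ _ ⟩
    (count PQ m + indicator (PQ m)) + (count P¬Q m + indicator (P¬Q m)) ∎
    where
    open ≡-Reasoning
    PQ  = λ y → P? y ×-dec Q? y
    P¬Q = λ y → P? y ×-dec ¬? (Q? y)
    +-assoc-swap : ∀ a b c d → (a + b) + (c + d) ≡ (a + c) + (b + d)
    +-assoc-swap = solve-∀

count-interval : ∀ i j m → m ≤ suc j → count (λ y → (i <? y) ×-dec (y ≤? j)) m ≡ m ∸ suc i
count-interval i j zero    _ = refl
count-interval i j (suc m) m≤j with i <? m
... | yes i<m = begin
  count I m + indicator (I m) ≡⟨ cong₂ _+_ (count-interval i j m (<⇒≤ m≤j)) (indicator-yes (I m) (i<m , s≤s⁻¹ m≤j)) ⟩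
  m ∸ suc i + 1               ≡⟨ +-comm (m ∸ suc i) 1 ⟩
  suc (m ∸ suc i)             ≡⟨ sym (+-∸-assoc 1 i<m) ⟩
  suc m ∸ suc i               ∎
  where
  open ≡-Reasoning
  I = λ y → (i <? y) ×-dec (y ≤? j)
... | no i≮m = begin
  count I m + indicator (I m) ≡⟨ cong₂ _+_ (count-interval i j m (<⇒≤ m≤j)) (indicator-no (I m) (i≮m ∘ proj₁)) ⟩
  m ∸ suc i + 0               ≡⟨ cong (_+ 0) (m≤n⇒m∸n≡0 (≤-trans (≮⇒≥ i≮m) (n≤1+n i))) ⟩
  0                           ≡⟨ sym (m≤n⇒m∸n≡0 (≮⇒≥ i≮m)) ⟩
  suc m ∸ suc i               ∎
  where
  open ≡-Reasoning
  I = λ y → (i <? y) ×-dec (y ≤? j)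

count-multiples : {P : ℕ → Set} (P? : ∀ y → Dec (P y)) (p : ℕ) .{{_ : NonZero p}} → ∀ b →
  count (λ y → P? y ×-dec (p ∣? y)) (p * b) ≡ count (λ z → P? (p * z)) b
count-multiples P? (suc p′) zero rewrite *-zeroʳ p′ = refl
count-multiples {P} P? p@(suc p′) (suc b) = begin
  count D (p * suc b)
    ≡⟨ cong (count D) (trans (*-suc p b) (+-comm p (p * b))) ⟩
  count D (p * b + p)
    ≡⟨ count-+ D (p * b) p ⟩
  count D (p * b) + count (λ y → D (p * b + y)) (1 + p′)
    ≡⟨ cong (count D (p * b) +_) (count-+ (λ y → D (p * b + y)) 1 p′) ⟩
  count D (p * b) + (0 + indicator (D (p * b + 0)) + count (λ y → D (p * b + suc y)) p′)
    ≡⟨ cong₂ (λ u v → count D (p * b) + (u + v)) (indicator-cong (D (p * b + 0)) (P? (p * b)) at-multiple)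
                                                   (count-none _ p′ between-multiples) ⟩
  count D (p * b) + (indicator (P? (p * b)) + 0)
    ≡⟨ cong₂ _+_ (count-multiples P? p b) (+-identityʳ _) ⟩
  count (λ z → P? (p * z)) b + indicator (P? (p * b)) ∎
  where
  open ≡-Reasoning
  D = λ y → P? y ×-dec (p ∣? y)
  at-multiple : (P (p * b + 0) × p ∣ p * b + 0) ⇔ P (p * b)
  at-multiple = mk⇔ (λ (Pp , _) → subst P (+-identityʳ _) Pp)
                    (λ Pp → subst P (sym (+-identityʳ _)) Pp , subst (p ∣_) (sym (+-identityʳ _)) (m∣m*n b))
  between-multiples : ∀ y → y < p′ → ¬ (P (p * b + suc y) × p ∣ p * b + suc y)
  between-multiples y y<p′ (_ , p∣) = <⇒≱ (s≤s y<p′) (∣⇒≤ (∣m+n∣m⇒∣n p∣ (m∣m*n b)))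

coprime-prime⇔∤ : ∀ {p y} → Prime p → Coprime y p ⇔ p ∤ y
coprime-prime⇔∤ {p} {y} p-prime = mk⇔ coprime⇒∤ ∤⇒coprime
  where
  coprime⇒∤ : Coprime y p → p ∤ y
  coprime⇒∤ coprime p∣y = nonTrivial⇒≢1 {{prime⇒nonTrivial p-prime}} (coprime (p∣y , ∣-refl))
  ∤⇒coprime : p ∤ y → Coprime y p
  ∤⇒coprime p∤y (i∣y , i∣p) with prime⇒irreducible p-prime i∣p
  ... | inj₁ i≡1  = i≡1
  ... | inj₂ refl = ⊥-elim (p∤y i∣y)

coprime-*ʳ⇔ : ∀ {y} m n → Coprime y (m * n) ⇔ (Coprime y m × Coprime y n)
coprime-*ʳ⇔ {y} m n = mk⇔ split coprime-*ʳ
  where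
  coprime-∣ʳ : ∀ {k} → Coprime y (m * n) → k ∣ m * n → Coprime y k
  coprime-∣ʳ c k∣mn (i∣y , i∣k) = c (i∣y , ∣-trans i∣k k∣mn)
  split : Coprime y (m * n) → Coprime y m × Coprime y n
  split c = coprime-∣ʳ c (m∣m*n n) , coprime-∣ʳ c (n∣m*n m)
  coprime-*ʳ : Coprime y m × Coprime y n → Coprime y (m * n)
  coprime-*ʳ (cm , cn) (i∣y , i∣mn) = cn (i∣y , coprime-divisor (λ (j∣i , j∣m) → cm (∣-trans j∣i i∣y , j∣m)) i∣mn)

coprime-*ˡ-redundant : ∀ {y p m} → p ∣ m → Coprime y (p * m) ⇔ Coprime y m
coprime-*ˡ-redundant {y} {p} {m} p∣m = mk⇔ (proj₂ ∘ to (coprime-*ʳ⇔ p m)) coprime-*ˡ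
  where
  coprime-*ˡ : Coprime y m → Coprime y (p * m)
  coprime-*ˡ c = from (coprime-*ʳ⇔ p m) ((λ (i∣y , i∣p) → c (i∣y , ∣-trans i∣p p∣m)) , c)

coprime-*-prime⇔ : ∀ {y p m} → Prime p → Coprime y (p * m) ⇔ (Coprime y m × p ∤ y)
coprime-*-prime⇔ {y} {p} {m} p-prime = mk⇔ split combine
  where
  split : Coprime y (p * m) → Coprime y m × p ∤ y
  split c = proj₂ (to (coprime-*ʳ⇔ p m) c) , to (coprime-prime⇔∤ p-prime) (proj₁ (to (coprime-*ʳ⇔ p m) c))
  combine : Coprime y m × p ∤ y → Coprime y (p * m)
  combine (c , p∤y) = from (coprime-*ʳ⇔ p m) (from (coprime-prime⇔∤ p-prime) p∤y , c)

coprime-prime-*ˡ⇔ : ∀ {z p m} → Prime p → p ∤ m → Coprime (p * z) m ⇔ Coprime z m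
coprime-prime-*ˡ⇔ {z} {p} {m} p-prime p∤m = mk⇔ cancel extend
  where
  cancel : Coprime (p * z) m → Coprime z m
  cancel c = Coprime.sym (proj₂ (to (coprime-*ʳ⇔ p z) (Coprime.sym c)))
  extend : Coprime z m → Coprime (p * z) m
  extend c = Coprime.sym (from (coprime-*ʳ⇔ p z) (from (coprime-prime⇔∤ p-prime) p∤m , Coprime.sym c))

primeFactorFrom : ∀ s k fuel → .{{NonTrivial k}} → k Rough s → k ≤ s → s ∸ k ≤ fuel →
  Σ[ p ∈ ℕ ] Prime p × p ∣ s × p Rough s
primeFactorFrom s k@(suc (suc _)) fuel rough k≤s fuel-bound with k ∣? s
... | yes k∣s = k , rough∧∣⇒prime rough k∣s , k∣s , rough
primeFactorFrom s k zero rough k≤s fuel-bound | no k∤s =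
  ⊥-elim (k∤s (subst (k ∣_) (≤-antisym k≤s (m∸n≡0⇒m≤n (n≤0⇒n≡0 fuel-bound))) ∣-refl))
primeFactorFrom s k (suc fuel) rough k≤s fuel-bound | no k∤s =
  primeFactorFrom s (suc k) fuel (∤⇒rough-suc k∤s rough) k<s (≤-pred (≤-trans (≤-reflexive (sym (+-∸-assoc 1 k<s))) fuel-bound))
  where
  k<s : k < s
  k<s with m≤n⇒m<n∨m≡n k≤s
  ... | inj₁ k<s = k<s
  ... | inj₂ refl = ⊥-elim (k∤s ∣-refl)

smallestPrimeFactor : ∀ s → 2 ≤ s → Σ[ p ∈ ℕ ] Prime p × p ∣ s × p Rough s
smallestPrimeFactor s 2≤s = primeFactorFrom s 2 s 2-rough 2≤s (m∸n≤m s 2)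

rough∧prime∣⇒≤ : ∀ {m n p} → m Rough n → Prime p → p ∣ n → m ≤ p
rough∧prime∣⇒≤ {m} {n} {p} rough p-prime p∣n with p <? m
... | yes p<m = ⊥-elim (rough (hasNonTrivialDivisor {{prime⇒nonTrivial p-prime}} p<m p∣n))
... | no p≮m  = ≮⇒≥ p≮m

m<o*n⇔m/o<n : ∀ m n o .{{_ : NonZero o}} → m < o * n ⇔ m / o < n
m<o*n⇔m/o<n m n o = mk⇔ (λ m<o*n → m<n*o⇒m/o<n (subst (m <_) (*-comm o n) m<o*n)) from-quotient
  where
  open ≤-Reasoning
  from-quotient : m / o < n → m < o * n
  from-quotient m/o<n = begin-strict
    m                     ≡⟨ m≡m%n+[m/n]*n m o ⟩
    m % o + m / o * o     <⟨ +-monoˡ-< (m / o * o) (m%n<n m o) ⟩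
    o + m / o * o         ≤⟨ *-monoˡ-≤ o m/o<n ⟩
    n * o                 ≡⟨ *-comm n o ⟩
    o * n                 ∎

o*n≤m⇔n≤m/o : ∀ m n o .{{_ : NonZero o}} → o * n ≤ m ⇔ n ≤ m / o
o*n≤m⇔n≤m/o m n o = mk⇔
  (λ o*n≤m → subst (_≤ m / o) (m*n/n≡m n o) (/-monoˡ-≤ o (subst (_≤ m) (*-comm o n) o*n≤m)))
  (λ n≤m/o → ≤-trans (≤-trans (≤-reflexive (*-comm o n)) (*-monoˡ-≤ o n≤m/o)) (m/n*n≤m m o))

InWindow : ℕ → ℕ → ℕ → ℕ → ℕ → Set
InWindow α β B t y = α < B * y × B * y ≤ β × Coprime y t

inWindow? : ∀ α β B t y → Dec (InWindow α β B t y)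
inWindow? α β B t y = (α <? B * y) ×-dec (B * y ≤? β) ×-dec Coprime.coprime? y t

coprimeCount : ℕ → ℕ → ℕ → ℕ → ℕ
coprimeCount α β B t = count (inWindow? α β B t) (suc β)

-- Both bounds are stated with all terms moved so that no subtraction occurs; they say that
-- coprimeCount α β B s differs from (β - α) · density / (s · B) by at most error.
record SieveBound (s : ℕ) : Set where
  field
    density error : ℕ
    upper : ∀ α β B → 1 ≤ B → α ≤ β →
      s * B * coprimeCount α β B s + α * density ≤ β * density + s * B * error
    lower : ∀ α β B → 1 ≤ B → α ≤ β →
      β * density ≤ s * B * coprimeCount α β B s + α * density + s * B * error
    exact : ∀ α β B → 1 ≤ B → α ≤ β → s * B ∣ α → s * B ∣ β →
      s * B * coprimeCount α β B s + α * density ≡ β * density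
    error-positive : 1 ≤ error
    error-growth : ∀ m → m Rough s → ∀ r → error ^ r ≤ 2 ^ (r * (2 ^ r ∸ m)) * s

coprimeCount-1 : ∀ α β B .{{_ : NonZero B}} → coprimeCount α β B 1 ≡ β / B ∸ α / B
coprimeCount-1 α β B = begin
  count (inWindow? α β B 1) (suc β)      ≡⟨ count-cong (inWindow? α β B 1) I (suc β) (λ y _ → window⇔interval y) ⟩
  count I (suc β)                        ≡⟨ count-bounded I (suc (β / B)) (suc β) (λ _ (_ , y≤b) → s≤s y≤b) (s≤s (m/n≤m β B)) ⟩
  count I (suc (β / B))                  ≡⟨ count-interval (α / B) (β / B) (suc (β / B)) ≤-refl ⟩
  β / B ∸ α / B                          ∎
  where
  open ≡-Reasoning
  I = λ y → (α / B <? y) ×-dec (y ≤? β / B)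
  window⇔interval : ∀ y → InWindow α β B 1 y ⇔ (α / B < y × y ≤ β / B)
  window⇔interval y = mk⇔
    (λ (α<By , By≤β , _) → to (m<o*n⇔m/o<n α y B) α<By , to (o*n≤m⇔n≤m/o β y B) By≤β)
    (λ (α/B<y , y≤β/B) → from (m<o*n⇔m/o<n α y B) α/B<y , from (o*n≤m⇔n≤m/o β y B) y≤β/B , λ (_ , d∣1) → ∣1⇒≡1 d∣1)

floor-difference : ∀ α β B .{{_ : NonZero B}} → α ≤ β → B * (β / B ∸ α / B) + α + β % B ≡ β + α % B
floor-difference α β B α≤β = begin
  B * (b ∸ a) + α + β % B                 ≡⟨ cong (λ x → B * (b ∸ a) + x + β % B) (m≡m%n+[m/n]*n α B) ⟩
  B * (b ∸ a) + (α % B + a * B) + β % B   ≡⟨ regroup B (b ∸ a) a (α % B) (β % B) ⟩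
  β % B + (b ∸ a + a) * B + α % B         ≡⟨ cong (λ x → β % B + x * B + α % B) (m∸n+n≡m (/-monoˡ-≤ B α≤β)) ⟩
  β % B + b * B + α % B                   ≡⟨ cong (_+ α % B) (sym (m≡m%n+[m/n]*n β B)) ⟩
  β + α % B                               ∎
  where
  open ≡-Reasoning
  a = α / B
  b = β / B
  regroup : ∀ B d a rα rβ → B * d + (rα + a * B) + rβ ≡ rβ + (d + a) * B + rα
  regroup = solve-∀

sieveBound-1 : SieveBound 1
sieveBound-1 = record
  { density = 1 ; error = 1 ; upper = upper ; lower = lower ; exact = exact
  ; error-positive = ≤-refl ; error-growth = error-growth }
  where
  open ≤-Reasoning
  unit-left : ∀ B F α → 1 * B * F + α * 1 ≡ B * F + α
  unit-left = solve-∀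
  unit-right : ∀ β B → β * 1 + 1 * B * 1 ≡ β + B
  unit-right = solve-∀
  unit-lower : ∀ B F α → B * F + α + B ≡ 1 * B * F + α * 1 + 1 * B * 1
  unit-lower = solve-∀
  upper : ∀ α β B → 1 ≤ B → α ≤ β → 1 * B * coprimeCount α β B 1 + α * 1 ≤ β * 1 + 1 * B * 1
  upper α β B@(suc _) _ α≤β = begin
    1 * B * coprimeCount α β B 1 + α * 1   ≡⟨ trans (unit-left B _ α) (cong (λ F → B * F + α) (coprimeCount-1 α β B)) ⟩
    B * (β / B ∸ α / B) + α                ≤⟨ m≤m+n _ (β % B) ⟩
    B * (β / B ∸ α / B) + α + β % B        ≡⟨ floor-difference α β B α≤β ⟩
    β + α % B                              ≤⟨ +-monoʳ-≤ β (<⇒≤ (m%n<n α B)) ⟩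
    β + B                                  ≡⟨ sym (unit-right β B) ⟩
    β * 1 + 1 * B * 1                      ∎
  lower : ∀ α β B → 1 ≤ B → α ≤ β → β * 1 ≤ 1 * B * coprimeCount α β B 1 + α * 1 + 1 * B * 1
  lower α β B@(suc _) _ α≤β = begin
    β * 1                                  ≡⟨ *-identityʳ β ⟩
    β                                      ≤⟨ m≤m+n β (α % B) ⟩
    β + α % B                              ≡⟨ sym (floor-difference α β B α≤β) ⟩
    B * (β / B ∸ α / B) + α + β % B        ≤⟨ +-monoʳ-≤ _ (<⇒≤ (m%n<n β B)) ⟩
    B * (β / B ∸ α / B) + α + B            ≡⟨ cong (λ x → x + α + B) (cong (B *_) (sym (coprimeCount-1 α β B))) ⟩
    B * coprimeCount α β B 1 + α + B       ≡⟨ unit-lower B (coprimeCount α β B 1) α ⟩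
    1 * B * coprimeCount α β B 1 + α * 1 + 1 * B * 1 ∎
  exact : ∀ α β B → 1 ≤ B → α ≤ β → 1 * B ∣ α → 1 * B ∣ β → 1 * B * coprimeCount α β B 1 + α * 1 ≡ β * 1
  exact α β B@(suc _) _ α≤β B∣α B∣β = begin-equality
    1 * B * coprimeCount α β B 1 + α * 1   ≡⟨ trans (unit-left B _ α) (cong (λ F → B * F + α) (coprimeCount-1 α β B)) ⟩
    B * (β / B ∸ α / B) + α                ≡⟨ sym (trans (cong (B * (β / B ∸ α / B) + α +_) (n∣m⇒m%n≡0 β B (subst (_∣ β) (*-identityˡ B) B∣β))) (+-identityʳ _)) ⟩
    B * (β / B ∸ α / B) + α + β % B        ≡⟨ floor-difference α β B α≤β ⟩
    β + α % B                              ≡⟨ cong (β +_) (n∣m⇒m%n≡0 α B (subst (_∣ α) (*-identityˡ B) B∣α)) ⟩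
    β + 0                                  ≡⟨ +-identityʳ β ⟩
    β                                      ≡⟨ sym (*-identityʳ β) ⟩
    β * 1                                  ∎
  error-growth : ∀ m → m Rough 1 → ∀ r → 1 ^ r ≤ 2 ^ (r * (2 ^ r ∸ m)) * 1
  error-growth m _ r = begin
    1 ^ r                       ≡⟨ ^-zeroˡ r ⟩
    1                           ≤⟨ m^n>0 2 (r * (2 ^ r ∸ m)) ⟩
    2 ^ (r * (2 ^ r ∸ m))       ≡⟨ sym (*-identityʳ _) ⟩
    2 ^ (r * (2 ^ r ∸ m)) * 1   ∎

coprimeCount-redundant : ∀ α β B {p m} → p ∣ m → coprimeCount α β B (p * m) ≡ coprimeCount α β B m
coprimeCount-redundant α β B p∣m = count-cong (inWindow? α β B _) (inWindow? α β B _) (suc β)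
  (λ y _ → mk⇔ (λ (l , u , c) → l , u , to (coprime-*ˡ-redundant p∣m) c)
               (λ (l , u , c) → l , u , from (coprime-*ˡ-redundant p∣m) c))

-- A y coprime to m is either coprime to p·m, or y = p·z with z coprime to m and α < (p·B)·z ≤ β.
coprimeCount-sieve : ∀ α β B {p m} → 1 ≤ B → Prime p → p ∤ m →
  coprimeCount α β B (p * m) + coprimeCount α β (p * B) m ≡ coprimeCount α β B m
coprimeCount-sieve α β B {p} {m} 1≤B p-prime p∤m = begin
  coprimeCount α β B (p * m) + coprimeCount α β (p * B) m ≡⟨ +-comm (coprimeCount α β B (p * m)) _ ⟩
  coprimeCount α β (p * B) m + coprimeCount α β B (p * m) ≡⟨ cong₂ _+_ (sym multiples) (sym non-multiples) ⟩
  count W∣ (suc β) + count W∤ (suc β)                      ≡⟨ sym (count-split (inWindow? α β B m) (p ∣?_) (suc β)) ⟩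
  coprimeCount α β B m                                    ∎
  where
  open ≡-Reasoning
  instance _ = prime⇒nonZero p-prime
  W∣ = λ y → inWindow? α β B m y ×-dec (p ∣? y)
  W∤ = λ y → inWindow? α β B m y ×-dec ¬? (p ∣? y)
  reassociate : ∀ z → B * (p * z) ≡ p * B * z
  reassociate z = trans (sym (*-assoc B p z)) (cong (_* z) (*-comm B p))
  below : ∀ y → InWindow α β B m y × p ∣ y → y < suc β
  below y ((_ , By≤β , _) , _) = s≤s (≤-trans (m≤n*m y B {{>-nonZero 1≤B}}) By≤β)
  multiples : count W∣ (suc β) ≡ coprimeCount α β (p * B) m
  multiples = begin
    count W∣ (suc β)                               ≡⟨ sym (count-bounded W∣ (suc β) (p * suc β) below (m≤n*m (suc β) p)) ⟩
    count W∣ (p * suc β)                           ≡⟨ count-multiples (inWindow? α β B m) p (suc β) ⟩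
    count (λ z → inWindow? α β B m (p * z)) (suc β) ≡⟨ count-cong _ (inWindow? α β (p * B) m) (suc β) (λ z _ → window⇔ z) ⟩
    coprimeCount α β (p * B) m                     ∎
    where
    window⇔ : ∀ z → InWindow α β B m (p * z) ⇔ InWindow α β (p * B) m z
    window⇔ z = mk⇔
      (λ (l , u , c) → subst (α <_) (reassociate z) l , subst (_≤ β) (reassociate z) u , to (coprime-prime-*ˡ⇔ p-prime p∤m) c)
      (λ (l , u , c) → subst (α <_) (sym (reassociate z)) l , subst (_≤ β) (sym (reassociate z)) u , from (coprime-prime-*ˡ⇔ p-prime p∤m) c)
  non-multiples : count W∤ (suc β) ≡ coprimeCount α β B (p * m)
  non-multiples = count-cong W∤ (inWindow? α β B (p * m)) (suc β) λ y _ → mk⇔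
    (λ ((l , u , c) , p∤y) → l , u , from (coprime-*-prime⇔ p-prime) (c , p∤y))
    (λ (l , u , c) → (l , u , proj₁ (to (coprime-*-prime⇔ p-prime) c)) , proj₂ (to (coprime-*-prime⇔ p-prime) c))

^-distribʳ-* : ∀ m n r → (m * n) ^ r ≡ m ^ r * n ^ r
^-distribʳ-* m n zero    = refl
^-distribʳ-* m n (suc r) = trans (cong (m * n *_) (^-distribʳ-* m n r)) (interchange m n (m ^ r) (n ^ r))
  where
  interchange : ∀ m n a b → m * n * (a * b) ≡ m * a * (n * b)
  interchange = solve-∀

sieveBound-repeatedPrime : ∀ {p m} → Prime p → p ∣ m → p Rough (p * m) → SieveBound m → SieveBound (p * m)
sieveBound-repeatedPrime {p} {m} p-prime p∣m p-rough bound = record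
  { density = p * ψ ; error = e ; upper = upper ; lower = lower ; exact = exact
  ; error-positive = SieveBound.error-positive bound ; error-growth = error-growth }
  where
  open SieveBound bound using () renaming (density to ψ; error to e)
  instance _ = prime⇒nonZero p-prime
  F = λ α β B → coprimeCount α β B m
  scale-upper : ∀ p m B F α β ψ e → m * B * F + α * ψ ≤ β * ψ + m * B * e →
    p * m * B * F + α * (p * ψ) ≤ β * (p * ψ) + p * m * B * e
  scale-upper p m B F α β ψ e h = subst₂ _≤_ (lhs p m B F α ψ) (rhs p m B β ψ e) (*-monoʳ-≤ p h)
    where
    lhs : ∀ p m B F α ψ → p * (m * B * F + α * ψ) ≡ p * m * B * F + α * (p * ψ)
    lhs = solve-∀
    rhs : ∀ p m B β ψ e → p * (β * ψ + m * B * e) ≡ β * (p * ψ) + p * m * B * e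
    rhs = solve-∀
  scale-lower : ∀ p m B F α β ψ e → β * ψ ≤ m * B * F + α * ψ + m * B * e →
    β * (p * ψ) ≤ p * m * B * F + α * (p * ψ) + p * m * B * e
  scale-lower p m B F α β ψ e h = subst₂ _≤_ (lhs p β ψ) (rhs p m B F α ψ e) (*-monoʳ-≤ p h)
    where
    lhs : ∀ p β ψ → p * (β * ψ) ≡ β * (p * ψ)
    lhs = solve-∀
    rhs : ∀ p m B F α ψ e → p * (m * B * F + α * ψ + m * B * e) ≡ p * m * B * F + α * (p * ψ) + p * m * B * e
    rhs = solve-∀
  scale-exact : ∀ p m B F α β ψ → m * B * F + α * ψ ≡ β * ψ → p * m * B * F + α * (p * ψ) ≡ β * (p * ψ)
  scale-exact p m B F α β ψ h = trans (lhs p m B F α ψ) (trans (cong (p *_) h) (rhs p β ψ))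
    where
    lhs : ∀ p m B F α ψ → p * m * B * F + α * (p * ψ) ≡ p * (m * B * F + α * ψ)
    lhs = solve-∀
    rhs : ∀ p β ψ → p * (β * ψ) ≡ β * (p * ψ)
    rhs = solve-∀
  divides-m*B : ∀ {B x} → p * m * B ∣ x → m * B ∣ x
  divides-m*B {B} = ∣-trans (subst (m * B ∣_) (sym (*-assoc p m B)) (n∣m*n p))
  upper : ∀ α β B → 1 ≤ B → α ≤ β →
    p * m * B * coprimeCount α β B (p * m) + α * (p * ψ) ≤ β * (p * ψ) + p * m * B * e
  upper α β B 1≤B α≤β rewrite coprimeCount-redundant α β B p∣m = scale-upper p m B (F α β B) α β ψ e (SieveBound.upper bound α β B 1≤B α≤β)
  lower : ∀ α β B → 1 ≤ B → α ≤ β →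
    β * (p * ψ) ≤ p * m * B * coprimeCount α β B (p * m) + α * (p * ψ) + p * m * B * e
  lower α β B 1≤B α≤β rewrite coprimeCount-redundant α β B p∣m = scale-lower p m B (F α β B) α β ψ e (SieveBound.lower bound α β B 1≤B α≤β)
  exact : ∀ α β B → 1 ≤ B → α ≤ β → p * m * B ∣ α → p * m * B ∣ β →
    p * m * B * coprimeCount α β B (p * m) + α * (p * ψ) ≡ β * (p * ψ)
  exact α β B 1≤B α≤β ∣α ∣β rewrite coprimeCount-redundant α β B p∣m =
    scale-exact p m B (F α β B) α β ψ (SieveBound.exact bound α β B 1≤B α≤β (divides-m*B ∣α) (divides-m*B ∣β))
  error-growth : ∀ k → k Rough (p * m) → ∀ r → e ^ r ≤ 2 ^ (r * (2 ^ r ∸ k)) * (p * m)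
  error-growth k k-rough r = ≤-trans (SieveBound.error-growth bound p (rough∧∣⇒rough p-rough (n∣m*n p)) r)
    (*-mono-≤ (^-monoʳ-≤ 2 (*-monoʳ-≤ r (∸-monoʳ-≤ (2 ^ r) (rough∧prime∣⇒≤ k-rough p-prime (m∣m*n m))))) (m≤n*m m p))

-- A new prime p multiplies error^r by 2^r: when p < 2^r this is paid for by one fewer
-- candidate small prime (p + 1 instead of k), otherwise by the factor p itself.
error-growth-doubling : ∀ p m k e r .{{_ : NonZero p}} → k ≤ p → e ^ r ≤ 2 ^ (r * (2 ^ r ∸ suc p)) * m →
  (2 * e) ^ r ≤ 2 ^ (r * (2 ^ r ∸ k)) * (p * m)
error-growth-doubling p m k e r k≤p growth with p <? 2 ^ r
... | yes p<2^r = begin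
  (2 * e) ^ r                              ≡⟨ ^-distribʳ-* 2 e r ⟩
  2 ^ r * e ^ r                            ≤⟨ *-monoʳ-≤ (2 ^ r) growth ⟩
  2 ^ r * (2 ^ (r * (2 ^ r ∸ suc p)) * m)   ≡⟨ sym (*-assoc (2 ^ r) _ m) ⟩
  2 ^ r * 2 ^ (r * (2 ^ r ∸ suc p)) * m     ≡⟨ cong (_* m) (sym (^-distribˡ-+-* 2 r _)) ⟩
  2 ^ (r + r * (2 ^ r ∸ suc p)) * m         ≡⟨ cong (λ x → 2 ^ x * m) (trans (sym (*-suc r _)) (cong (r *_) (sym (+-∸-assoc 1 p<2^r)))) ⟩
  2 ^ (r * (2 ^ r ∸ p)) * m                 ≤⟨ *-mono-≤ (^-monoʳ-≤ 2 (*-monoʳ-≤ r (∸-monoʳ-≤ (2 ^ r) k≤p))) (m≤n*m m p) ⟩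
  2 ^ (r * (2 ^ r ∸ k)) * (p * m)           ∎
  where open ≤-Reasoning
... | no p≮2^r = begin
  (2 * e) ^ r                              ≡⟨ ^-distribʳ-* 2 e r ⟩
  2 ^ r * e ^ r                            ≤⟨ *-monoʳ-≤ (2 ^ r) growth ⟩
  2 ^ r * (2 ^ (r * (2 ^ r ∸ suc p)) * m)   ≡⟨ cong (λ x → 2 ^ r * (2 ^ (r * x) * m)) (m≤n⇒m∸n≡0 (≤-trans (≮⇒≥ p≮2^r) (n≤1+n p))) ⟩
  2 ^ r * (2 ^ (r * 0) * m)                 ≡⟨ cong (λ x → 2 ^ r * (2 ^ x * m)) (*-zeroʳ r) ⟩
  2 ^ r * (1 * m)                           ≡⟨ cong (2 ^ r *_) (*-identityˡ m) ⟩
  2 ^ r * m                                 ≤⟨ *-monoˡ-≤ m (≮⇒≥ p≮2^r) ⟩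
  p * m                                     ≤⟨ m≤n*m (p * m) (2 ^ (r * (2 ^ r ∸ k))) {{m^n≢0 2 (r * (2 ^ r ∸ k))}} ⟩
  2 ^ (r * (2 ^ r ∸ k)) * (p * m)           ∎
  where open ≤-Reasoning

-- With X + Y the count for m at scale B and Y its count at scale p·B, the bounds for m combine
-- into the bounds for p·m with density p′·ψ and error 2·e.
module _ (p′ m B X Y α β ψ e : ℕ) where
  private
    p = suc p′

  sieve-upper : m * B * (X + Y) + α * ψ ≤ β * ψ + m * B * e →
    β * ψ ≤ m * (p * B) * Y + α * ψ + m * (p * B) * e →
    p * m * B * X + α * (p′ * ψ) ≤ β * (p′ * ψ) + p * m * B * (2 * e)
  sieve-upper h₁ h₂ = +-cancelʳ-≤ (m * (p * B) * Y + α * ψ + β * ψ) _ _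
    (subst₂ _≤_ (lhs p′ m B X Y α β ψ) (rhs p′ m B Y α β ψ e) (+-mono-≤ (*-monoʳ-≤ p h₁) h₂))
    where
    lhs : ∀ p′ m B X Y α β ψ → suc p′ * (m * B * (X + Y) + α * ψ) + β * ψ ≡
      suc p′ * m * B * X + α * (p′ * ψ) + (m * (suc p′ * B) * Y + α * ψ + β * ψ)
    lhs = solve-∀
    rhs : ∀ p′ m B Y α β ψ e → suc p′ * (β * ψ + m * B * e) + (m * (suc p′ * B) * Y + α * ψ + m * (suc p′ * B) * e) ≡
      β * (p′ * ψ) + suc p′ * m * B * (2 * e) + (m * (suc p′ * B) * Y + α * ψ + β * ψ)
    rhs = solve-∀

  sieve-lower : β * ψ ≤ m * B * (X + Y) + α * ψ + m * B * e →
    m * (p * B) * Y + α * ψ ≤ β * ψ + m * (p * B) * e →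
    β * (p′ * ψ) ≤ p * m * B * X + α * (p′ * ψ) + p * m * B * (2 * e)
  sieve-lower h₁ h₂ = +-cancelʳ-≤ (m * (p * B) * Y + α * ψ + β * ψ) _ _
    (subst₂ _≤_ (lhs p′ m B Y α β ψ) (rhs p′ m B X Y α β ψ e) (+-mono-≤ (*-monoʳ-≤ p h₁) h₂))
    where
    lhs : ∀ p′ m B Y α β ψ → suc p′ * (β * ψ) + (m * (suc p′ * B) * Y + α * ψ) ≡
      β * (p′ * ψ) + (m * (suc p′ * B) * Y + α * ψ + β * ψ)
    lhs = solve-∀
    rhs : ∀ p′ m B X Y α β ψ e → suc p′ * (m * B * (X + Y) + α * ψ + m * B * e) + (β * ψ + m * (suc p′ * B) * e) ≡
      suc p′ * m * B * X + α * (p′ * ψ) + suc p′ * m * B * (2 * e) + (m * (suc p′ * B) * Y + α * ψ + β * ψ)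
    rhs = solve-∀

  sieve-exact : m * B * (X + Y) + α * ψ ≡ β * ψ → m * (p * B) * Y + α * ψ ≡ β * ψ →
    p * m * B * X + α * (p′ * ψ) ≡ β * (p′ * ψ)
  sieve-exact h₁ h₂ = +-cancelʳ-≡ (β * ψ) _ _ (begin
    p * m * B * X + α * (p′ * ψ) + β * ψ                              ≡⟨ cong (p * m * B * X + α * (p′ * ψ) +_) (sym h₂) ⟩
    p * m * B * X + α * (p′ * ψ) + (m * (p * B) * Y + α * ψ)          ≡⟨ regroup p′ m B X Y α ψ ⟩
    p * (m * B * (X + Y) + α * ψ)                                     ≡⟨ cong (p *_) h₁ ⟩
    p * (β * ψ)                                                       ≡⟨ split p′ β ψ ⟩
    β * (p′ * ψ) + β * ψ                                              ∎)
    where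
    open ≡-Reasoning
    regroup : ∀ p′ m B X Y α ψ → suc p′ * m * B * X + α * (p′ * ψ) + (m * (suc p′ * B) * Y + α * ψ) ≡
      suc p′ * (m * B * (X + Y) + α * ψ)
    regroup = solve-∀
    split : ∀ p′ β ψ → suc p′ * (β * ψ) ≡ β * (p′ * ψ) + β * ψ
    split = solve-∀

sieveBound-newPrime : ∀ {p m} → Prime p → p ∤ m → p Rough (p * m) → SieveBound m → SieveBound (p * m)
sieveBound-newPrime {zero} p-prime = ⊥-elim (≢-nonZero⁻¹ 0 {{prime⇒nonZero p-prime}} refl)
sieveBound-newPrime {p@(suc p′)} {m} p-prime p∤m p-rough bound = record
  { density = p′ * ψ ; error = 2 * e ; upper = upper ; lower = lower ; exact = exact
  ; error-positive = ≤-trans (SieveBound.error-positive bound) (m≤n*m e 2) ; error-growth = error-growth }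
  where
  open SieveBound bound using () renaming (density to ψ; error to e)
  F = λ α β B → coprimeCount α β B m
  split : ∀ α β B → 1 ≤ B → coprimeCount α β B m ≡ coprimeCount α β B (p * m) + coprimeCount α β (p * B) m
  split α β B 1≤B = sym (coprimeCount-sieve α β B 1≤B p-prime p∤m)
  1≤p*B : ∀ {B} → 1 ≤ B → 1 ≤ p * B
  1≤p*B {B} 1≤B = ≤-trans 1≤B (m≤n*m B p)
  upper : ∀ α β B → 1 ≤ B → α ≤ β →
    p * m * B * coprimeCount α β B (p * m) + α * (p′ * ψ) ≤ β * (p′ * ψ) + p * m * B * (2 * e)
  upper α β B 1≤B α≤β = sieve-upper p′ m B _ (F α β (p * B)) α β ψ e
    (subst (λ F → m * B * F + α * ψ ≤ β * ψ + m * B * e) (split α β B 1≤B) (SieveBound.upper bound α β B 1≤B α≤β))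
    (SieveBound.lower bound α β (p * B) (1≤p*B 1≤B) α≤β)
  lower : ∀ α β B → 1 ≤ B → α ≤ β →
    β * (p′ * ψ) ≤ p * m * B * coprimeCount α β B (p * m) + α * (p′ * ψ) + p * m * B * (2 * e)
  lower α β B 1≤B α≤β = sieve-lower p′ m B _ (F α β (p * B)) α β ψ e
    (subst (λ F → β * ψ ≤ m * B * F + α * ψ + m * B * e) (split α β B 1≤B) (SieveBound.lower bound α β B 1≤B α≤β))
    (SieveBound.upper bound α β (p * B) (1≤p*B 1≤B) α≤β)
  exact : ∀ α β B → 1 ≤ B → α ≤ β → p * m * B ∣ α → p * m * B ∣ β →
    p * m * B * coprimeCount α β B (p * m) + α * (p′ * ψ) ≡ β * (p′ * ψ)
  exact α β B 1≤B α≤β ∣α ∣β = sieve-exact p′ m B _ (F α β (p * B)) α β ψ e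
    (subst (λ F → m * B * F + α * ψ ≡ β * ψ) (split α β B 1≤B)
      (SieveBound.exact bound α β B 1≤B α≤β (divides-m*B ∣α) (divides-m*B ∣β)))
    (SieveBound.exact bound α β (p * B) (1≤p*B 1≤B) α≤β (divides-m*pB ∣α) (divides-m*pB ∣β))
    where
    divides-m*B : ∀ {x} → p * m * B ∣ x → m * B ∣ x
    divides-m*B = ∣-trans (subst (m * B ∣_) (sym (*-assoc p m B)) (n∣m*n p))
    divides-m*pB : ∀ {x} → p * m * B ∣ x → m * (p * B) ∣ x
    divides-m*pB {x} = subst (_∣ x) (trans (cong (_* B) (*-comm p m)) (*-assoc m p B))
  error-growth : ∀ k → k Rough (p * m) → ∀ r → (2 * e) ^ r ≤ 2 ^ (r * (2 ^ r ∸ k)) * (p * m)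
  error-growth k k-rough r = error-growth-doubling p m k e r (rough∧prime∣⇒≤ k-rough p-prime (m∣m*n m))
    (SieveBound.error-growth bound (suc p) (∤⇒rough-suc p∤m (rough∧∣⇒rough p-rough (n∣m*n p))) r)

sieveBound : ∀ s .{{_ : NonZero s}} → SieveBound s
sieveBound s = <-rec (λ s → 1 ≤ s → SieveBound s) step s (>-nonZero⁻¹ s)
  where
  step : ∀ s → (∀ {t} → t < s → 1 ≤ t → SieveBound t) → 1 ≤ s → SieveBound s
  step (suc zero)          _   _ = sieveBound-1
  step s@(suc (suc _)) rec _ with smallestPrimeFactor s (s≤s (s≤s z≤n))
  ... | p , p-prime , p∣s , p-rough = subst SieveBound (sym s≡p*q) extend
    where
    instance _ = prime⇒nonTrivial p-prime
    q = quotient p∣s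
    s≡p*q : s ≡ p * q
    s≡p*q = m∣n⇒n≡m*quotient p∣s
    bound : SieveBound q
    bound = rec (quotient-< p∣s) (>-nonZero⁻¹ q {{quotient≢0 p∣s}})
    extend : SieveBound (p * q)
    extend with p ∣? q
    ... | yes p∣q = sieveBound-repeatedPrime p-prime p∣q (subst (p Rough_) s≡p*q p-rough) bound
    ... | no  p∤q = sieveBound-newPrime p-prime p∤q (subst (p Rough_) s≡p*q p-rough) bound

applyUpTo-cong : ∀ {A : Set} {f g : ℕ → A} → (∀ i → f i ≡ g i) → ∀ n → applyUpTo f n ≡ applyUpTo g n
applyUpTo-cong {f = f} {g} f≗g n = trans (sym (map-upTo f n)) (trans (map-cong f≗g (upTo n)) (map-upTo g n))

range-cons : ∀ k n → k ≤ n → range k n ≡ k ∷ range (suc k) n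
range-cons k n k≤n rewrite +-∸-assoc 1 k≤n = refl

range-nil : ∀ k n → n < k → range k n ≡ []
range-nil k n n<k rewrite m≤n⇒m∸n≡0 n<k = refl

range-from : ∀ k l → range (suc k) (k + l) ≡ applyUpTo (λ i → suc (k + i)) l
range-from k zero    = range-nil (suc k) (k + 0) (s≤s (≤-reflexive (+-identityʳ k)))
range-from k (suc l) = begin
  range (suc k) (k + suc l)                            ≡⟨ range-cons (suc k) (k + suc l) (subst (suc k ≤_) (sym (+-suc k l)) (s≤s (m≤m+n k l))) ⟩
  suc k ∷ range (suc (suc k)) (k + suc l)              ≡⟨ cong (λ x → suc k ∷ range (suc (suc k)) x) (+-suc k l) ⟩
  suc k ∷ range (suc (suc k)) (suc k + l)              ≡⟨ cong (suc k ∷_) (range-from (suc k) l) ⟩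
  suc k ∷ applyUpTo (λ i → suc (suc k + i)) l          ≡⟨ cong₂ _∷_ (cong suc (sym (+-identityʳ k))) (applyUpTo-cong (λ i → cong suc (sym (+-suc k i))) l) ⟩
  applyUpTo (λ i → suc (k + i)) (suc l)                ∎
  where open ≡-Reasoning

range-1 : ∀ n → range 1 n ≡ applyUpTo suc n
range-1 = range-from 0

module _ {A : Set} {P : A → Set} (P? : ∀ x → Dec (P x)) where

  length-filter-[_] : ∀ x → length (filter P? [ x ]) ≡ indicator (P? x)
  length-filter-[ x ] with does (P? x)
  ... | true  = refl
  ... | false = refl

  length-filter-applyUpTo : ∀ f n → length (filter P? (applyUpTo f n)) ≡ count (P? ∘ f) n
  length-filter-applyUpTo f zero    = refl
  length-filter-applyUpTo f (suc n) = begin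
    length (filter P? (applyUpTo f (suc n)))                     ≡⟨ cong (length ∘ filter P?) (sym (applyUpTo-∷ʳ f n)) ⟩
    length (filter P? (applyUpTo f n ++ [ f n ]))                ≡⟨ cong length (filter-++ P? (applyUpTo f n) [ f n ]) ⟩
    length (filter P? (applyUpTo f n) ++ filter P? [ f n ])      ≡⟨ length-++ (filter P? (applyUpTo f n)) ⟩
    length (filter P? (applyUpTo f n)) + length (filter P? [ f n ]) ≡⟨ cong₂ _+_ (length-filter-applyUpTo f n) length-filter-[ f n ] ⟩
    count (P? ∘ f) n + indicator (P? (f n))                     ∎
    where open ≡-Reasoning

module _ {A B : Set} {P : A × B → Set} (P? : ∀ p → Dec (P p)) where

  length-filter-cartesianProduct : ∀ xs ys →
    length (filter P? (cartesianProduct xs ys)) ≡ sum (map (λ x → length (filter P? (map (x ,_) ys))) xs)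
  length-filter-cartesianProduct []       ys = refl
  length-filter-cartesianProduct (x ∷ xs) ys = begin
    length (filter P? (map (x ,_) ys ++ cartesianProduct xs ys))
      ≡⟨ cong length (filter-++ P? (map (x ,_) ys) (cartesianProduct xs ys)) ⟩
    length (filter P? (map (x ,_) ys) ++ filter P? (cartesianProduct xs ys))
      ≡⟨ length-++ (filter P? (map (x ,_) ys)) ⟩
    length (filter P? (map (x ,_) ys)) + length (filter P? (cartesianProduct xs ys))
      ≡⟨ cong (length (filter P? (map (x ,_) ys)) +_) (length-filter-cartesianProduct xs ys) ⟩
    length (filter P? (map (x ,_) ys)) + sum (map (λ x → length (filter P? (map (x ,_) ys))) xs) ∎
    where open ≡-Reasoning

VisibleInterior : ℕ → ℕ → ℕ × ℕ → Set
VisibleInterior a n (x , y) = InteriorP a n (x , y) × gcd x y ≡ 1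

visibleInterior? : ∀ a n p → Dec (VisibleInterior a n p)
visibleInterior? a n (x , y) = interiorP? a n (x , y) ×-dec (gcd x y ≟ 1)

column : ℕ → ℕ → ℕ → ℕ
column a n x = count (λ i → visibleInterior? a n (x , suc i)) n

columnWindow : ℕ → ℕ → ℕ → ℕ
columnWindow a n s = coprimeCount (pred s * n) (s * n) a s

V≡sum-columns : ∀ a n → V a n ≡ sum (map (column a n) (applyUpTo suc (suc a)))
V≡sum-columns a n = begin
  V a n
    ≡⟨ length-filter-cartesianProduct (visibleInterior? a n) (range 1 (suc a)) (range 1 n) ⟩
  sum (map (λ x → length (filter (visibleInterior? a n) (map (x ,_) (range 1 n)))) (range 1 (suc a)))
    ≡⟨ cong₂ (λ xs ys → sum (map (λ x → length (filter (visibleInterior? a n) (map (x ,_) ys))) xs)) (range-1 (suc a)) (range-1 n) ⟩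
  sum (map (λ x → length (filter (visibleInterior? a n) (map (x ,_) (applyUpTo suc n)))) (applyUpTo suc (suc a)))
    ≡⟨ cong sum (map-cong column≡ (applyUpTo suc (suc a))) ⟩
  sum (map (column a n) (applyUpTo suc (suc a))) ∎
  where
  open ≡-Reasoning
  column≡ : ∀ x → length (filter (visibleInterior? a n) (map (x ,_) (applyUpTo suc n))) ≡ column a n x
  column≡ x = trans (cong (length ∘ filter (visibleInterior? a n)) (map-applyUpTo suc (x ,_) n))
                    (length-filter-applyUpTo (visibleInterior? a n) (λ i → x , suc i) n)

sum-map-∷ʳ : ∀ (f : ℕ → ℕ) xs x → sum (map f (xs ∷ʳ x)) ≡ sum (map f xs) + f x
sum-map-∷ʳ f xs x = trans (cong sum (map-++ f xs [ x ])) (trans (sum-++ (map f xs) [ f x ]) (cong (sum (map f xs) +_) (+-identityʳ (f x))))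

module _ (a′ n′ : ℕ) (a⊥n : Coprime (suc a′) (suc n′)) where

  private
    a = suc a′
    n = suc n′

  visibleInterior⇔window : ∀ s′ y → y < n →
    VisibleInterior a n (suc s′ , y) ⇔ InWindow (s′ * n) (suc s′ * n) a (suc s′) y
  visibleInterior⇔window s′ y y<n = mk⇔ to-window from-window
    where
    s = suc s′
    to-window : VisibleInterior a n (s , y) → InWindow (s′ * n) (s * n) a s y
    to-window ((_ , ay<ns , ns<ay+n) , visible) =
      subst (_< a * y) (*-comm n s′) (+-cancelˡ-< n (n * s′) (a * y) (subst₂ _<_ (*-suc n s′) (+-comm (a * y) n) ns<ay+n)) ,
      subst (a * y ≤_) (*-comm n s) (<⇒≤ ay<ns) ,
      Coprime.sym (gcd≡1⇒coprime visible)
    from-window : InWindow (s′ * n) (s * n) a s y → VisibleInterior a n (s , y)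
    from-window (s′n<ay , ay≤sn , y⊥s) =
      ((0<y , y<n) , ay<ns , subst₂ _<_ (sym (*-suc n s′)) (+-comm n (a * y)) (+-monoʳ-< n (subst (_< a * y) (*-comm s′ n) s′n<ay))) ,
      coprime⇒gcd≡1 (Coprime.sym y⊥s)
      where
      instance _ = m*n≢0⇒n≢0 a {{>-nonZero (≤-<-trans z≤n s′n<ay)}}
      0<y : 0 < y
      0<y = >-nonZero⁻¹ y
      -- a·y = s·n would force n ∣ y, impossible for 0 < y < n.
      ay<ns : a * y < n * s
      ay<ns with m≤n⇒m<n∨m≡n ay≤sn
      ... | inj₁ ay<sn = subst (a * y <_) (*-comm s n) ay<sn
      ... | inj₂ ay≡sn = ⊥-elim (<⇒≱ y<n (∣⇒≤ (coprime-divisor (Coprime.sym a⊥n) (divides s ay≡sn))))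

  column+boundary : ∀ s′ → suc s′ ≤ a →
    column a n (suc s′) + indicator (inWindow? (s′ * n) (suc s′ * n) a (suc s′) n) ≡ columnWindow a n (suc s′)
  column+boundary s′ s≤a = begin
    column a n s + indicator (W n)                          ≡⟨⟩
    count (D ∘ suc) n′ + indicator (D n) + indicator (W n)  ≡⟨ cong (λ x → count (D ∘ suc) n′ + x + indicator (W n)) (indicator-no (D n) (λ (((_ , n<n) , _) , _) → <-irrefl refl n<n)) ⟩
    count (D ∘ suc) n′ + 0 + indicator (W n)                ≡⟨ cong (_+ indicator (W n)) (trans (+-identityʳ _) (count-cong (D ∘ suc) (W ∘ suc) n′ (λ i i<n′ → visibleInterior⇔window s′ (suc i) (s≤s i<n′)))) ⟩
    count (W ∘ suc) n                                       ≡⟨ sym (trans (count-+ W 1 n) (cong (_+ count (W ∘ suc) n) (indicator-no (W 0) (λ (s′n<0 , _) → n≮0 (subst (s′ * n <_) (*-zeroʳ a) s′n<0))))) ⟩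
    count W (1 + n)                                         ≡⟨ sym (count-bounded W (suc n) (suc (s * n)) (λ y (_ , ay≤sn , _) → s≤s (*-cancelˡ-≤ a (≤-trans ay≤sn (*-monoˡ-≤ n s≤a)))) (s≤s (m≤n*m n s))) ⟩
    columnWindow a n s                                      ∎
    where
    open ≡-Reasoning
    s = suc s′
    D = λ y → visibleInterior? a n (s , y)
    W = inWindow? (s′ * n) (s * n) a s
    instance _ = >-nonZero (≤-trans (s≤s z≤n) s≤a)

  column-beyond : column a n (suc a) ≡ 0
  column-beyond = count-none _ n (λ i _ (((_ , y<n) , _ , n[a+1]<ay+n) , _) →
    <⇒≱ n[a+1]<ay+n (begin
      a * suc i + n   ≤⟨ +-monoˡ-≤ n (*-monoʳ-≤ a (<⇒≤ y<n)) ⟩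
      a * n + n       ≡⟨ regroup a n ⟩
      n * suc a       ∎))
    where
    open ≤-Reasoning
    regroup : ∀ a n → a * n + n ≡ n * suc a
    regroup = solve-∀

  boundary-inner : ∀ s′ → suc s′ < a → indicator (inWindow? (s′ * n) (suc s′ * n) a (suc s′) n) ≡ 0
  boundary-inner s′ s<a = indicator-no (inWindow? (s′ * n) (suc s′ * n) a (suc s′) n) (λ (_ , an≤sn , _) → <⇒≱ s<a (*-cancelʳ-≤ a (suc s′) n an≤sn))

  boundary-last : indicator (inWindow? (a′ * n) (a * n) a a n) ≡ 1
  boundary-last = indicator-yes (inWindow? (a′ * n) (a * n) a a n)
    (*-monoˡ-< n {a′} {a} ≤-refl , ≤-refl , Coprime.sym a⊥n)

  V+1≡sum-columnWindows : V a n + 1 ≡ sum (map (columnWindow a n) (applyUpTo suc a))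
  V+1≡sum-columnWindows = begin
    V a n + 1                                                      ≡⟨ cong (_+ 1) (V≡sum-columns a n) ⟩
    sum (map (column a n) (applyUpTo suc (suc a))) + 1             ≡⟨ cong (λ xs → sum (map (column a n) xs) + 1) (sym (applyUpTo-∷ʳ suc a)) ⟩
    sum (map (column a n) (applyUpTo suc a ∷ʳ suc a)) + 1          ≡⟨ cong (_+ 1) (trans (sum-map-∷ʳ (column a n) (applyUpTo suc a) (suc a)) (trans (cong (sum (map (column a n) (applyUpTo suc a)) +_) column-beyond) (+-identityʳ _))) ⟩
    sum (map (column a n) (applyUpTo suc a)) + 1                   ≡⟨ cong (λ xs → sum (map (column a n) xs) + 1) (sym (applyUpTo-∷ʳ suc a′)) ⟩
    sum (map (column a n) (applyUpTo suc a′ ∷ʳ a)) + 1             ≡⟨ cong (_+ 1) (sum-map-∷ʳ (column a n) (applyUpTo suc a′) a) ⟩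
    sum (map (column a n) (applyUpTo suc a′)) + column a n a + 1   ≡⟨ +-assoc (sum (map (column a n) (applyUpTo suc a′))) (column a n a) 1 ⟩
    sum (map (column a n) (applyUpTo suc a′)) + (column a n a + 1) ≡⟨ cong₂ _+_ (cong sum inner-columns) last-column ⟩
    sum (map (columnWindow a n) (applyUpTo suc a′)) + columnWindow a n a ≡⟨ sym (sum-map-∷ʳ (columnWindow a n) (applyUpTo suc a′) a) ⟩
    sum (map (columnWindow a n) (applyUpTo suc a′ ∷ʳ a))           ≡⟨ cong (sum ∘ map (columnWindow a n)) (applyUpTo-∷ʳ suc a′) ⟩
    sum (map (columnWindow a n) (applyUpTo suc a))                 ∎
    where
    open ≡-Reasoning
    inner-columns : map (column a n) (applyUpTo suc a′) ≡ map (columnWindow a n) (applyUpTo suc a′)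
    inner-columns = map-cong-local (applyUpTo⁺₁ suc a′ λ {s′} s′<a′ →
      trans (sym (trans (cong (column a n (suc s′) +_) (boundary-inner s′ (s≤s s′<a′))) (+-identityʳ _)))
            (column+boundary s′ (<⇒≤ (s≤s s′<a′))))
    last-column : column a n a + 1 ≡ columnWindow a n a
    last-column = trans (cong (column a n a +_) (sym boundary-last)) (column+boundary a′ ≤-refl)

sieveError : ℕ → ℕ
sieveError zero    = 0
sieveError (suc s) = SieveBound.error (sieveBound (suc s))

growthConstant : ℕ → ℕ
growthConstant r = 2 ^ (r * (2 ^ r ∸ 2))

sieveError-growth : ∀ s .{{_ : NonZero s}} r → sieveError s ^ r ≤ growthConstant r * s
sieveError-growth (suc s) r = SieveBound.error-growth (sieveBound (suc s)) 2 2-rough r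

φ≡coprimeCount : ∀ s → φ s ≡ coprimeCount 0 s 1 s
φ≡coprimeCount s = begin
  φ s                                                   ≡⟨ cong (length ∘ filter (λ k → gcd k s ≟ 1)) (range-1 s) ⟩
  length (filter (λ k → gcd k s ≟ 1) (applyUpTo suc s)) ≡⟨ length-filter-applyUpTo (λ k → gcd k s ≟ 1) suc s ⟩
  count (λ i → gcd (suc i) s ≟ 1) s                     ≡⟨ count-cong _ (W ∘ suc) s coprime⇔window ⟩
  count (W ∘ suc) s                                     ≡⟨ sym (trans (count-+ W 1 s) (cong (_+ count (W ∘ suc) s) (indicator-no (W 0) (λ ())))) ⟩
  coprimeCount 0 s 1 s                                  ∎
  where
  open ≡-Reasoning
  W = inWindow? 0 s 1 s
  coprime⇔window : ∀ i → i < s → gcd (suc i) s ≡ 1 ⇔ InWindow 0 s 1 s (suc i)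
  coprime⇔window i i<s = mk⇔
    (λ g → s≤s z≤n , subst (_≤ s) (sym (*-identityˡ (suc i))) i<s , λ {d} → gcd≡1⇒coprime g {d})
    (λ (_ , _ , i+1⊥s) → coprime⇒gcd≡1 i+1⊥s)

φ≡density : ∀ s .{{_ : NonZero s}} → φ s ≡ SieveBound.density (sieveBound s)
φ≡density s@(suc _) = *-cancelˡ-≡ (φ s) ψ s (begin
  s * φ s                                  ≡⟨ cong (s *_) (φ≡coprimeCount s) ⟩
  s * coprimeCount 0 s 1 s                 ≡⟨ sym (trans (+-identityʳ _) (cong (_* coprimeCount 0 s 1 s) (*-identityʳ s))) ⟩
  s * 1 * coprimeCount 0 s 1 s + 0 * ψ     ≡⟨ SieveBound.exact (sieveBound s) 0 s 1 ≤-refl z≤n ((s * 1) ∣0) (subst (_∣ s) (sym (*-identityʳ s)) ∣-refl) ⟩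
  s * ψ                                    ∎)
  where
  open ≡-Reasoning
  ψ = SieveBound.density (sieveBound s)

module _ (a n s′ : ℕ) (1≤a : 1 ≤ a) where
  private
    s = suc s′
    ψ = SieveBound.density (sieveBound s)
    W = columnWindow a n s
    s′n≤sn = *-monoˡ-≤ n (n≤1+n s′)

  columnWindow-upper : s * a * W ≤ n * φ s + s * a * sieveError s
  columnWindow-upper = +-cancelʳ-≤ (s′ * n * ψ) _ _ (begin
    s * a * W + s′ * n * ψ                       ≤⟨ SieveBound.upper (sieveBound s) (s′ * n) (s * n) a 1≤a s′n≤sn ⟩
    s * n * ψ + s * a * sieveError s             ≡⟨ regroup s′ n ψ (s * a * sieveError s) ⟩
    n * ψ + s * a * sieveError s + s′ * n * ψ    ≡⟨ cong (λ x → n * x + s * a * sieveError s + s′ * n * ψ) (sym (φ≡density s)) ⟩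
    n * φ s + s * a * sieveError s + s′ * n * ψ  ∎)
    where
    open ≤-Reasoning
    regroup : ∀ s′ n ψ E → suc s′ * n * ψ + E ≡ n * ψ + E + s′ * n * ψ
    regroup = solve-∀

  columnWindow-lower : n * φ s ≤ s * a * W + s * a * sieveError s
  columnWindow-lower = +-cancelʳ-≤ (s′ * n * ψ) _ _ (begin
    n * φ s + s′ * n * ψ                           ≡⟨ cong (λ x → n * x + s′ * n * ψ) (φ≡density s) ⟩
    n * ψ + s′ * n * ψ                             ≡⟨ regroup s′ n ψ ⟩
    s * n * ψ                                      ≤⟨ SieveBound.lower (sieveBound s) (s′ * n) (s * n) a 1≤a s′n≤sn ⟩
    s * a * W + s′ * n * ψ + s * a * sieveError s  ≡⟨ swap (s * a * W) (s′ * n * ψ) (s * a * sieveError s) ⟩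
    s * a * W + s * a * sieveError s + s′ * n * ψ  ∎)
    where
    open ≤-Reasoning
    regroup : ∀ s′ n ψ → n * ψ + s′ * n * ψ ≡ suc s′ * n * ψ
    regroup = solve-∀
    swap : ∀ x y z → x + y + z ≡ x + z + y
    swap = solve-∀

-- Opened only from here on: its prefix +_ makes ℕ sections such as (m +_) ambiguous.
open ℤ using (+_)

module _ where
  private
    toℚᵘ-/ : ∀ x d .{{_ : NonZero d}} → toℚᵘ ((+ x) ℚ./ d) ℚᵘ.≃ (+ x) ℚᵘ./ d
    toℚᵘ-/ x (suc d) = ℚP.toℚᵘ-fromℚᵘ (mkℚᵘ (+ x) d)
      where open ℚᵘ using (mkℚᵘ)

    via-ℚᵘ : ∀ {p q : ℚ} {u v} → toℚᵘ p ℚᵘ.≃ u → u ℚᵘ.≃ v → toℚᵘ q ℚᵘ.≃ v → p ≡ q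
    via-ℚᵘ p≃u u≃v q≃v = ℚP.toℚᵘ-injective (ℚᵘP.≃-trans p≃u (ℚᵘP.≃-trans u≃v (ℚᵘP.≃-sym q≃v)))

    ℚᵘ-cross : ∀ {x y d e} .{{_ : NonZero d}} .{{_ : NonZero e}} →
      x * e ≡ y * d → (+ x) ℚᵘ./ d ℚᵘ.≃ (+ y) ℚᵘ./ e
    ℚᵘ-cross {x} {y} {d@(suc _)} {e@(suc _)} eq = *≡* (trans (sym (ℤP.pos-* x e)) (trans (cong +_ eq) (ℤP.pos-* y d)))

  /-≡-/ : ∀ x y d e .{{_ : NonZero d}} .{{_ : NonZero e}} → x * e ≡ y * d → (+ x) ℚ./ d ≡ (+ y) ℚ./ e
  /-≡-/ x y d e eq = via-ℚᵘ (toℚᵘ-/ x d) (ℚᵘ-cross eq) (toℚᵘ-/ y e)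

  /-≤-/ : ∀ x y d e .{{_ : NonZero d}} .{{_ : NonZero e}} → x * e ≤ y * d → (+ x) ℚ./ d ℚ.≤ (+ y) ℚ./ e
  /-≤-/ x y d@(suc _) e@(suc _) le = ℚP.toℚᵘ-cancel-≤ (ℚᵘP.≤-respˡ-≃ (ℚᵘP.≃-sym (toℚᵘ-/ x d)) (ℚᵘP.≤-respʳ-≃ (ℚᵘP.≃-sym (toℚᵘ-/ y e))
    (*≤* (subst₂ ℤ._≤_ (ℤP.pos-* x e) (ℤP.pos-* y d) (ℤ.+≤+ le)))))

  /-<-/ : ∀ x y d e .{{_ : NonZero d}} .{{_ : NonZero e}} → x * e < y * d → (+ x) ℚ./ d ℚ.< (+ y) ℚ./ e
  /-<-/ x y d@(suc _) e@(suc _) lt = ℚP.toℚᵘ-cancel-< (ℚᵘP.<-respˡ-≃ (ℚᵘP.≃-sym (toℚᵘ-/ x d)) (ℚᵘP.<-respʳ-≃ (ℚᵘP.≃-sym (toℚᵘ-/ y e))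
    (*<* (subst₂ ℤ._<_ (ℤP.pos-* x e) (ℤP.pos-* y d) (ℤ.+<+ lt)))))

  /-+-/ : ∀ x y d e .{{_ : NonZero d}} .{{_ : NonZero e}} →
    (+ x) ℚ./ d ℚ.+ (+ y) ℚ./ e ≡ ((+ (x * e + y * d)) ℚ./ (d * e)) {{m*n≢0 d e}}
  /-+-/ x y d@(suc _) e@(suc _) = via-ℚᵘ
    (ℚᵘP.≃-trans (ℚP.toℚᵘ-homo-+ ((+ x) ℚ./ d) ((+ y) ℚ./ e)) (ℚᵘP.+-cong (toℚᵘ-/ x d) (toℚᵘ-/ y e)))
    (ℚᵘP.≃-reflexive (cong (λ z → (z ℚᵘ./ (d * e))) (trans (cong₂ ℤ._+_ (sym (ℤP.pos-* x e)) (sym (ℤP.pos-* y d))) (sym (ℤP.pos-+ (x * e) (y * d))))))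
    (toℚᵘ-/ (x * e + y * d) (d * e))

  /-*-/ : ∀ x y d e .{{_ : NonZero d}} .{{_ : NonZero e}} →
    ((+ x) ℚ./ d) ℚ.* ((+ y) ℚ./ e) ≡ ((+ (x * y)) ℚ./ (d * e)) {{m*n≢0 d e}}
  /-*-/ x y d@(suc _) e@(suc _) = via-ℚᵘ
    (ℚᵘP.≃-trans (ℚP.toℚᵘ-homo-* ((+ x) ℚ./ d) ((+ y) ℚ./ e)) (ℚᵘP.*-cong (toℚᵘ-/ x d) (toℚᵘ-/ y e)))
    (ℚᵘP.≃-reflexive (cong (ℚᵘ._/ (d * e)) (sym (ℤP.pos-* x y))))
    (toℚᵘ-/ (x * y) (d * e))

/+/ : ∀ x y d .{{_ : NonZero d}} → (+ x) ℚ./ d ℚ.+ (+ y) ℚ./ d ≡ (+ (x + y)) ℚ./ d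
/+/ x y d = trans (/-+-/ x y d d) (/-≡-/ (x * d + y * d) (x + y) (d * d) d {{m*n≢0 d d}} (regroup x y d))
  where
  regroup : ∀ x y d → (x * d + y * d) * d ≡ (x + y) * (d * d)
  regroup = solve-∀

module _ where
  open +-*-Solver

  sumℚ-/ : ∀ (g : ℕ → ℕ) d .{{_ : NonZero d}} xs → sumℚ (map (λ s → (+ g s) ℚ./ d) xs) ≡ (+ sum (map g xs)) ℚ./ d
  sumℚ-/ g d []       = sym (ℚP.0/n≡0 d)
  sumℚ-/ g d (x ∷ xs) = trans (cong ((+ g x) ℚ./ d ℚ.+_) (sumℚ-/ g d xs)) (/+/ (g x) (sum (map g xs)) d)

  sumℚ-linear : ∀ (f h : ℕ → ℚ) c xs →
    sumℚ (map (λ s → f s ℚ.- c ℚ.* h s) xs) ≡ sumℚ (map f xs) ℚ.- c ℚ.* sumℚ (map h xs)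
  sumℚ-linear f h c []       = solve 1 (λ c → con 0ℚ := con 0ℚ :- c :* con 0ℚ) refl c
  sumℚ-linear f h c (x ∷ xs) = trans (cong (f x ℚ.- c ℚ.* h x ℚ.+_) (sumℚ-linear f h c xs))
    (solve 5 (λ fx hx c F H → (fx :- c :* hx) :+ (F :- c :* H) := (fx :+ F) :- c :* (hx :+ H)) refl
       (f x) (h x) c (sumℚ (map f xs)) (sumℚ (map h xs)))

  ∣p-q∣≤r : ∀ p q r → p ℚ.≤ q ℚ.+ r → q ℚ.≤ p ℚ.+ r → ℚ.∣ p ℚ.- q ∣ ℚ.≤ r
  ∣p-q∣≤r p q r p≤q+r q≤p+r with ℚP.∣p∣≡p∨∣p∣≡-p (p ℚ.- q)
  ... | inj₁ ∣p-q∣≡p-q = subst (ℚ._≤ r) (sym ∣p-q∣≡p-q)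
    (subst (p ℚ.- q ℚ.≤_) (solve 2 (λ q r → q :+ r :- q := r) refl q r) (ℚP.+-monoˡ-≤ (ℚ.- q) p≤q+r))
  ... | inj₂ ∣p-q∣≡q-p = subst (ℚ._≤ r) (sym ∣p-q∣≡q-p)
    (subst₂ ℚ._≤_ (solve 2 (λ p q → q :- p := :- (p :- q)) refl p q) (solve 2 (λ p r → p :+ r :- p := r) refl p r)
      (ℚP.+-monoˡ-≤ (ℚ.- p) q≤p+r))

∣sumℚ∣≤sumℚ∣∣ : ∀ (f : ℕ → ℚ) xs → ℚ.∣ sumℚ (map f xs) ∣ ℚ.≤ sumℚ (map (ℚ.∣_∣ ∘ f) xs)
∣sumℚ∣≤sumℚ∣∣ f []       = ℚP.≤-refl
∣sumℚ∣≤sumℚ∣∣ f (x ∷ xs) = ℚP.≤-trans (ℚP.∣p+q∣≤∣p∣+∣q∣ (f x) _) (ℚP.+-monoʳ-≤ ℚ.∣ f x ∣ (∣sumℚ∣≤sumℚ∣∣ f xs))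

sumℚ-mono-≤ : ∀ {f h : ℕ → ℚ} {xs} → All (λ s → f s ℚ.≤ h s) xs → sumℚ (map f xs) ℚ.≤ sumℚ (map h xs)
sumℚ-mono-≤ []           = ℚP.≤-refl
sumℚ-mono-≤ (f≤h ∷ f≤hs) = ℚP.+-mono-≤ f≤h (sumℚ-mono-≤ f≤hs)

φ-ratio : ℕ → ℚ
φ-ratio zero    = 0ℚ
φ-ratio (suc s) = (+ φ (suc s)) ℚ./ suc s

mainTerm≡ : ∀ a .{{_ : NonZero a}} → mainTerm a ≡ ((+ 1) ℚ./ a) ℚ.* sumℚ (map φ-ratio (applyUpTo suc a))
mainTerm≡ a = cong (λ xs → ((+ 1) ℚ./ a) ℚ.* sumℚ xs)
  (trans (map-cong (λ { zero → refl ; (suc _) → refl }) (range 1 a)) (cong (map φ-ratio) (range-1 a)))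

column-estimate : ∀ a n s W Φ E .{{_ : NonZero a}} .{{_ : NonZero n}} .{{_ : NonZero s}} →
  s * a * W ≤ n * Φ + s * a * E → n * Φ ≤ s * a * W + s * a * E →
  ℚ.∣ (+ W) ℚ./ n ℚ.- ((+ 1) ℚ./ a) ℚ.* ((+ Φ) ℚ./ s) ∣ ℚ.≤ (+ E) ℚ./ n
column-estimate a@(suc _) n@(suc _) s@(suc _) W Φ E upper lower =
  subst (λ q → ℚ.∣ (+ W) ℚ./ n ℚ.- q ∣ ℚ.≤ (+ E) ℚ./ n) (sym (/-*-/ 1 Φ a s)) $ ∣p-q∣≤r ((+ W) ℚ./ n) ((+ (1 * Φ)) ℚ./ (a * s)) ((+ E) ℚ./ n)
    (subst ((+ W) ℚ./ n ℚ.≤_) (sym (/-+-/ (1 * Φ) E (a * s) n))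
      (/-≤-/ W (1 * Φ * n + E * (a * s)) n (a * s * n) (subst₂ _≤_ (lhs a s n W) (rhs a s n Φ E) (*-monoʳ-≤ n upper))))
    (subst ((+ (1 * Φ)) ℚ./ (a * s) ℚ.≤_) (sym (/+/ W E n))
      (/-≤-/ (1 * Φ) (W + E) (a * s) n (subst₂ _≤_ (unit n Φ) (swap a s W E) lower)))
  where
  lhs : ∀ a s n W → n * (s * a * W) ≡ W * (a * s * n)
  lhs = solve-∀
  rhs : ∀ a s n Φ E → n * (n * Φ + s * a * E) ≡ (1 * Φ * n + E * (a * s)) * n
  rhs = solve-∀
  unit : ∀ n Φ → n * Φ ≡ 1 * Φ * n
  unit = solve-∀
  swap : ∀ a s W E → s * a * W + s * a * E ≡ (W + E) * (a * s)
  swap = solve-∀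

∣x/n∣≡x/n : ∀ x n .{{_ : NonZero n}} → ℚ.∣ (+ x) ℚ./ n ∣ ≡ (+ x) ℚ./ n
∣x/n∣≡x/n x n = ℚP.0≤p⇒∣p∣≡p (subst (ℚ._≤ (+ x) ℚ./ n) (ℚP.0/n≡0 1) (/-≤-/ 0 x 1 n z≤n))

module _ (a′ n′ : ℕ) (a⊥n : Coprime (suc a′) (suc n′)) where
  private
    a = suc a′
    n = suc n′
    S = applyUpTo suc a
    c = (+ 1) ℚ./ a
    _/n : ℕ → ℚ
    x /n = (+ x) ℚ./ n
    T : ℕ → ℚ
    T s = columnWindow a n s /n ℚ.- c ℚ.* φ-ratio s

  V/n-mainTerm≡ : V a n /n ℚ.- mainTerm a ≡ sumℚ (map T S) ℚ.- 1 /n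
  V/n-mainTerm≡ = begin
    V a n /n ℚ.- mainTerm a
      ≡⟨ cong₂ ℚ._-_ V/n≡ (mainTerm≡ a) ⟩
    (sumℚ (map (_/n ∘ columnWindow a n) S) ℚ.- 1 /n) ℚ.- c ℚ.* sumℚ (map φ-ratio S)
      ≡⟨ solve 4 (λ W e c Φ → (W :- e) :- c :* Φ := (W :- c :* Φ) :- e) refl (sumℚ (map (_/n ∘ columnWindow a n) S)) (1 /n) c (sumℚ (map φ-ratio S)) ⟩
    (sumℚ (map (_/n ∘ columnWindow a n) S) ℚ.- c ℚ.* sumℚ (map φ-ratio S)) ℚ.- 1 /n
      ≡⟨ cong (ℚ._- 1 /n) (sym (sumℚ-linear (_/n ∘ columnWindow a n) φ-ratio c S)) ⟩
    sumℚ (map T S) ℚ.- 1 /n ∎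
    where
    open ≡-Reasoning
    open +-*-Solver
    V/n≡ : V a n /n ≡ sumℚ (map (_/n ∘ columnWindow a n) S) ℚ.- 1 /n
    V/n≡ = begin
      V a n /n                                          ≡⟨ solve 2 (λ v e → v := (v :+ e) :- e) refl (V a n /n) (1 /n) ⟩
      (V a n /n ℚ.+ 1 /n) ℚ.- 1 /n                      ≡⟨ cong (ℚ._- 1 /n) (/+/ (V a n) 1 n) ⟩
      (V a n + 1) /n ℚ.- 1 /n                           ≡⟨ cong (λ x → x /n ℚ.- 1 /n) (V+1≡sum-columnWindows a′ n′ a⊥n) ⟩
      sum (map (columnWindow a n) S) /n ℚ.- 1 /n        ≡⟨ cong (ℚ._- 1 /n) (sym (sumℚ-/ (columnWindow a n) n S)) ⟩
      sumℚ (map (_/n ∘ columnWindow a n) S) ℚ.- 1 /n    ∎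

  visibleCount-estimate : ℚ.∣ V a n /n ℚ.- mainTerm a ∣ ℚ.≤ (sum (map sieveError S) + 1) /n
  visibleCount-estimate = begin
    ℚ.∣ V a n /n ℚ.- mainTerm a ∣               ≡⟨ cong ℚ.∣_∣ V/n-mainTerm≡ ⟩
    ℚ.∣ sumℚ (map T S) ℚ.- 1 /n ∣                ≤⟨ ℚP.∣p-q∣≤∣p∣+∣q∣ (sumℚ (map T S)) (1 /n) ⟩
    ℚ.∣ sumℚ (map T S) ∣ ℚ.+ ℚ.∣ 1 /n ∣          ≡⟨ cong (ℚ.∣ sumℚ (map T S) ∣ ℚ.+_) (∣x/n∣≡x/n 1 n) ⟩
    ℚ.∣ sumℚ (map T S) ∣ ℚ.+ 1 /n                ≤⟨ ℚP.+-monoˡ-≤ (1 /n) (ℚP.≤-trans (∣sumℚ∣≤sumℚ∣∣ T S) (sumℚ-mono-≤ {ℚ.∣_∣ ∘ T} {_/n ∘ sieveError} (applyUpTo⁺₁ suc a term-estimate))) ⟩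
    sumℚ (map (_/n ∘ sieveError) S) ℚ.+ 1 /n    ≡⟨ cong (ℚ._+ 1 /n) (sumℚ-/ sieveError n S) ⟩
    sum (map sieveError S) /n ℚ.+ 1 /n          ≡⟨ /+/ (sum (map sieveError S)) 1 n ⟩
    (sum (map sieveError S) + 1) /n             ∎
    where
    open ℚP.≤-Reasoning
    term-estimate : ∀ {s′} → s′ < a → ℚ.∣ T (suc s′) ∣ ℚ.≤ sieveError (suc s′) /n
    term-estimate {s′} _ = column-estimate a n (suc s′) (columnWindow a n (suc s′)) (φ (suc s′)) (sieveError (suc s′))
      (columnWindow-upper a n s′ (s≤s z≤n)) (columnWindow-lower a n s′ (s≤s z≤n))

maxSieveError : ℕ → ℕ
maxSieveError a = sieveError (argmax sieveError 1 (applyUpTo suc a))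

sum-map-≤ : ∀ (f : ℕ → ℕ) M xs → All (λ x → f x ≤ M) xs → sum (map f xs) ≤ length xs * M
sum-map-≤ f M []       []           = z≤n
sum-map-≤ f M (x ∷ xs) (fx≤M ∷ f≤M) = +-mono-≤ fx≤M (sum-map-≤ f M xs f≤M)

sum-sieveError≤ : ∀ a → sum (map sieveError (applyUpTo suc a)) ≤ a * maxSieveError a
sum-sieveError≤ a = subst (λ k → sum (map sieveError (applyUpTo suc a)) ≤ k * maxSieveError a) (length-applyUpTo suc a)
  (sum-map-≤ sieveError (maxSieveError a) (applyUpTo suc a) (f[xs]≤f[argmax] 1 (applyUpTo suc a)))

maxSieveError-positive : ∀ a → 1 ≤ maxSieveError a
maxSieveError-positive a = argmax-all sieveError {P = λ s → 1 ≤ sieveError s} (positive 0)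
  (applyUpTo⁺₁ suc a (λ {s} _ → positive s))
  where
  positive : ∀ s → 1 ≤ sieveError (suc s)
  positive s = SieveBound.error-positive (sieveBound (suc s))

maxSieveError-growth : ∀ a r → 1 ≤ a → maxSieveError a ^ r ≤ growthConstant r * a
maxSieveError-growth a r 1≤a = argmax-all sieveError {P = λ s → sieveError s ^ r ≤ growthConstant r * a}
  (≤-trans (sieveError-growth 1 r) (*-monoʳ-≤ (growthConstant r) 1≤a))
  (applyUpTo⁺₁ suc a (λ {s} s<a → ≤-trans (sieveError-growth (suc s) r) (*-monoʳ-≤ (growthConstant r) s<a)))

^-cancelˡ-< : ∀ r {x y} → x ^ r < y ^ r → x < y
^-cancelˡ-< r {x} {y} xʳ<yʳ with x <? y
... | yes x<y = x<y
... | no  x≮y = ⊥-elim (<⇒≱ xʳ<yʳ (^-monoˡ-≤ r (≮⇒≥ x≮y)))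

threshold : ℕ → ℕ → ℕ → ℕ
threshold q′ c v = (2 * v) ^ (suc q′ + q′) * growthConstant (suc q′ + q′) * (c ^ suc q′ * c ^ suc q′)

a²-bound : ∀ q′ p c d a n .{{_ : NonZero d}} .{{_ : NonZero n}} → 1 ≤ p → BelowCPow c d p (suc q′) a n →
  a ^ suc q′ * a ^ suc q′ ≤ c ^ suc q′ * c ^ suc q′ * n ^ (q′ + q′)
a²-bound q′ p c d a n 1≤p below = begin
  a ^ q * a ^ q                               ≤⟨ *-mono-≤ aᵠ≤ aᵠ≤ ⟩
  (c ^ q * n ^ e) * (c ^ q * n ^ e)           ≡⟨ interchange (c ^ q) (n ^ e) ⟩
  c ^ q * c ^ q * (n ^ e * n ^ e)             ≡⟨ cong (c ^ q * c ^ q *_) (sym (^-distribˡ-+-* n e e)) ⟩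
  c ^ q * c ^ q * n ^ (e + e)                 ≤⟨ *-monoʳ-≤ (c ^ q * c ^ q) (^-monoʳ-≤ n (+-mono-≤ e≤q′ e≤q′)) ⟩
  c ^ q * c ^ q * n ^ (q′ + q′)               ∎
  where
  open ≤-Reasoning
  q = suc q′
  e = q ∸ p
  e≤q′ : e ≤ q′
  e≤q′ = ∸-monoʳ-≤ q 1≤p
  aᵠ≤ : a ^ q ≤ c ^ q * n ^ e
  aᵠ≤ = ≤-trans (^-monoˡ-≤ q (m≤m*n a d)) below
  interchange : ∀ x y → (x * y) * (x * y) ≡ x * x * (y * y)
  interchange = solve-∀

-- With r = 2q - 1, M^r ≤ K·a and a^(2q) ≤ C^(2q)·n^(2q-2) give (2v·a·M)^r ≤ threshold·n^(r-1).
errorSum<n : ∀ q′ p c d v a n M E .{{_ : NonZero d}} → 1 ≤ p → 1 ≤ a → 1 ≤ M →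
  E ≤ a * M → M ^ (suc q′ + q′) ≤ growthConstant (suc q′ + q′) * a →
  BelowCPow c d p (suc q′) a n → threshold q′ c v < n → (E + 1) * v < n
errorSum<n q′ p c d v a n M E 1≤p 1≤a 1≤M E≤aM Mʳ≤Ka below threshold<n =
  ≤-<-trans error-term≤X (^-cancelˡ-< r Xʳ<nʳ)
  where
  instance _ = >-nonZero (≤-<-trans z≤n threshold<n)
  q = suc q′
  r = q + q′
  X = 2 * v * a * M
  error-term≤X : (E + 1) * v ≤ X
  error-term≤X = ≤-trans (*-monoˡ-≤ v (+-mono-≤ E≤aM (*-mono-≤ 1≤a 1≤M))) (≤-reflexive (double a M v))
    where
    double : ∀ a M v → (a * M + a * M) * v ≡ 2 * v * a * M
    double = solve-∀
  Xʳ<nʳ : X ^ r < n ^ r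
  Xʳ<nʳ = begin-strict
    X ^ r                                                  ≡⟨ trans (^-distribʳ-* (2 * v * a) M r) (cong (_* M ^ r) (^-distribʳ-* (2 * v) a r)) ⟩
    (2 * v) ^ r * a ^ r * M ^ r                            ≤⟨ *-monoʳ-≤ ((2 * v) ^ r * a ^ r) Mʳ≤Ka ⟩
    (2 * v) ^ r * a ^ r * (growthConstant r * a)           ≡⟨ regroup ((2 * v) ^ r) (a ^ r) (growthConstant r) a ⟩
    (2 * v) ^ r * growthConstant r * (a ^ r * a)           ≡⟨ cong ((2 * v) ^ r * growthConstant r *_) aʳa≡aᵠaᵠ ⟩
    (2 * v) ^ r * growthConstant r * (a ^ q * a ^ q)       ≤⟨ *-monoʳ-≤ ((2 * v) ^ r * growthConstant r) (a²-bound q′ p c d a n 1≤p below) ⟩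
    (2 * v) ^ r * growthConstant r * (c ^ q * c ^ q * n ^ (q′ + q′)) ≡⟨ sym (*-assoc ((2 * v) ^ r * growthConstant r) (c ^ q * c ^ q) _) ⟩
    threshold q′ c v * n ^ (q′ + q′)                       <⟨ *-monoˡ-< (n ^ (q′ + q′)) {{m^n≢0 n (q′ + q′)}} threshold<n ⟩
    n * n ^ (q′ + q′)                                      ≡⟨⟩
    n ^ r                                                  ∎
    where
    open ≤-Reasoning
    regroup : ∀ V A K a → V * A * (K * a) ≡ V * K * (A * a)
    regroup = solve-∀
    aʳa≡aᵠaᵠ : a ^ r * a ≡ a ^ q * a ^ q
    aʳa≡aᵠaᵠ = trans (*-comm (a ^ r) a) (trans (cong (a ^_) (cong suc (sym (+-suc q′ q′)))) (^-distribˡ-+-* a q q))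

corollary9 : (p q : ℕ) → 0 < p → p < q
    → (c d : ℕ) → 0 < c → .{{_ : NonZero d}}
    → (η : ℚ) → 0ℚ ℚ.< η
    → Σ ℕ λ N → (n : ℕ) → n ≥ N → (a : ℕ) .{{_ : NonZero a}} → (n≢0 : NonZero n)
    → a < n → gcd a n ≡ 1 → BelowCPow c d p q a n
    → ℚ.∣ ((+ V a n) ℚ./ n) {{n≢0}} ℚ.- mainTerm a ∣ ℚ.< η
corollary9 p zero       _   ()
corollary9 p (suc q′) 1≤p _ c d _ η@(mkℚ ℤ.+[1+ u ] v _) _ = suc (threshold q′ c (suc v)) , estimate
  where
  estimate : (n : ℕ) → n > threshold q′ c (suc v) → (a : ℕ) .{{_ : NonZero a}} → (n≢0 : NonZero n)
    → a < n → gcd a n ≡ 1 → BelowCPow c d p (suc q′) a n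
    → ℚ.∣ ((+ V a n) ℚ./ n) {{n≢0}} ℚ.- mainTerm a ∣ ℚ.< η
  estimate (suc n′) n>threshold a@(suc a′) _ _ gcd≡1 below = begin-strict
    ℚ.∣ (+ V a n) ℚ./ n ℚ.- mainTerm a ∣   ≤⟨ visibleCount-estimate a′ n′ (gcd≡1⇒coprime gcd≡1) ⟩
    (+ (E + 1)) ℚ./ n                     <⟨ /-<-/ (E + 1) (suc u) n (suc v) (<-≤-trans E+1<n/v (m≤n*m n (suc u))) ⟩
    (+ suc u) ℚ./ suc v                   ≡⟨ ℚP.↥p/↧p≡p η ⟩
    η                                     ∎
    where
    open ℚP.≤-Reasoning
    n = suc n′
    E = sum (map sieveError (applyUpTo suc a))
    E+1<n/v : (E + 1) * suc v < n
    E+1<n/v = errorSum<n q′ p c d (suc v) a n (maxSieveError a) E 1≤p (s≤s z≤n) (maxSieveError-positive a)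
      (sum-sieveError≤ a) (maxSieveError-growth a (suc q′ + q′) (s≤s z≤n)) below n>threshold
corollary9 p (suc q′) _ _ c d _ (mkℚ (+ zero) _ _) (ℚ.*<* (ℤ.+<+ ()))
corollary9 p (suc q′) _ _ c d _ (mkℚ ℤ.-[1+ _ ] _ _) (ℚ.*<* ())
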